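{- Let $k\ge 1$ and let $f:\mathcal{PC}_{2k+2}\to\mathcal{PC}_{2k}$ be a graph homomorphism. If $x\neq y$ are vertices of $\mathcal{PC}_{2k+2}$ with $f(x)=f(y)$, then $x$ and $y$ have a common neighbor, i.e., they are at distance $2$.
   Context: The projective cube of dimension $d$, $\mathcal{PC}_d$, is the Cayley graph $\mathrm{Cay}(\mathbb{Z}_2^d,\{e_1,\dots,e_d,J\})$: vertex set $\mathbb{Z}_2^d$, with $u\sim v$ iff $u-v\in\{e_1,\dots,e_d,J\}$, where $e_1,\dots,e_d$ is the canonical basis and $J$ the all-ones vector. A homomorphism is a map of vertex sets sending edges to edges. -}

module Defs where

open import Data.Nat using (ℕ; zero; suc)
open import Data.Bool using (Bool; true; false; _xor_)
open import Data.Fin using (Fin)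
open import Data.Vec using (Vec; zipWith; replicate; tabulate)
open import Data.Sum using (_⊎_)
open import Data.Product using (∃)
open import Relation.Binary.PropositionalEquality using (_≡_)

-- Vertices of the projective cube PC_d: elements of Z_2^d, as bit vectors.
Vertex : ℕ → Set
Vertex d = Vec Bool d

_⊕_ : ∀ {d} → Vertex d → Vertex d → Vertex d
u ⊕ v = zipWith _xor_ u v

e : ∀ {d} → Fin d → Vertex d
e {d} i = tabulate λ j → isEq i j
  where
  open import Data.Fin using (_≟_)
  open import Relation.Nullary using (does)
  isEq : Fin d → Fin d → Bool
  isEq a b = does (a ≟ b)

J : ∀ {d} → Vertex d
J = replicate _ true

IsGen : ∀ {d} → Vertex d → Set
IsGen {d} s = (∃ λ (i : Fin d) → s ≡ e i) ⊎ (s ≡ J)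

Adj : ∀ {d} → Vertex d → Vertex d → Set
Adj u v = IsGen (u ⊕ v)

IsHom : ∀ {m n} → (Vertex m → Vertex n) → Set
IsHom {m} f = ∀ (u v : Vertex m) → Adj u v → Adj (f u) (f v)

CommonNeighbour : ∀ {d} → Vertex d → Vertex d → Set
CommonNeighbour {d} x y = ∃ λ (z : Vertex d) → Adj x z Data.Product.× Adj y z
  where import Data.Product

module Submission where

-- Write n = 2k and let w be the Hamming distance of x and y in
-- PC_(n+2).  There are two walks from x to y: the hypercube walk flipping the
-- w differing coordinates one at a time (length w), and the walk that first
-- steps along J and then flips the remaining n+2-w coordinates (length
-- n+3-w).  Their images under f are closed walks at f x = f y in PC_n, of
-- lengths summing to n+3, which is odd.  Since n is even, every closed walk
-- of odd length in PC_n has length at least n+1 (its odd girth), so one of the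
-- two lengths is odd and at least n+1, forcing the other to be at most 2, and
-- in fact 0 or 2.  Length 0 for the first walk would mean x = y; length 2
-- means either that x and y differ in exactly two coordinates, or that y is
-- one coordinate flip away from x + J; either way x and y have a common
-- neighbour.

open import Defs
open import Data.Nat using (ℕ; suc; _+_; _*_; _≤_)
open import Relation.Binary.PropositionalEquality using (_≡_)
open import Relation.Nullary using (¬_)
open import Data.Nat using (zero; z≤n; s≤s)
open import Data.Nat.Properties
  using (+-suc; +-comm; *-monoʳ-≤; +-identityʳ; +-mono-≤; +-monoʳ-≤; +-cancelʳ-≤; suc-injective; ≤-trans; n≤1+n)
open import Data.Bool using (Bool; true; false; not; _xor_)
open import Data.Bool.Properties using (xor-comm; xor-assoc; xor-same; xor-identityʳ; not-involutive; not-distribˡ-xor)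
open import Data.Fin using (Fin; zero; suc)
open import Data.Vec using ([]; _∷_; replicate; tabulate)
open import Data.Vec.Properties using (zipWith-comm; zipWith-assoc; zipWith-identityʳ)
open import Data.Product using (∃; _,_; _×_)
open import Data.Sum using (_⊎_; inj₁; inj₂)
open import Data.Empty using (⊥-elim)
open import Relation.Binary.PropositionalEquality using (refl; sym; trans; cong; cong₂; subst; subst₂; module ≡-Reasoning)

0ᵛ : ∀ {d} → Vertex d
0ᵛ = replicate _ false

⊕-comm : ∀ {d} (u v : Vertex d) → u ⊕ v ≡ v ⊕ u
⊕-comm = zipWith-comm xor-comm

⊕-assoc : ∀ {d} (u v w : Vertex d) → (u ⊕ v) ⊕ w ≡ u ⊕ (v ⊕ w)
⊕-assoc = zipWith-assoc xor-assoc

⊕-identityʳ : ∀ {d} (u : Vertex d) → u ⊕ 0ᵛ ≡ u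
⊕-identityʳ = zipWith-identityʳ xor-identityʳ

⊕-self : ∀ {d} (u : Vertex d) → u ⊕ u ≡ 0ᵛ
⊕-self []      = refl
⊕-self (b ∷ u) = cong₂ _∷_ (xor-same b) (⊕-self u)

⊕-cancelˡ : ∀ {d} (u v : Vertex d) → u ⊕ (u ⊕ v) ≡ v
⊕-cancelˡ u v = begin
  u ⊕ (u ⊕ v)  ≡⟨ sym (⊕-assoc u u v) ⟩
  (u ⊕ u) ⊕ v  ≡⟨ cong (_⊕ v) (⊕-self u) ⟩
  0ᵛ ⊕ v       ≡⟨ ⊕-comm 0ᵛ v ⟩
  v ⊕ 0ᵛ       ≡⟨ ⊕-identityʳ v ⟩
  v            ∎
  where open ≡-Reasoning

⊕-telescope : ∀ {d} (u v w : Vertex d) → u ⊕ w ≡ (v ⊕ w) ⊕ (u ⊕ v)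
⊕-telescope u v w = begin
  u ⊕ w              ≡⟨ ⊕-comm u w ⟩
  w ⊕ u              ≡⟨ cong (w ⊕_) (sym (⊕-cancelˡ v u)) ⟩
  w ⊕ (v ⊕ (v ⊕ u))  ≡⟨ sym (⊕-assoc w v (v ⊕ u)) ⟩
  (w ⊕ v) ⊕ (v ⊕ u)  ≡⟨ cong₂ _⊕_ (⊕-comm w v) (⊕-comm v u) ⟩
  (v ⊕ w) ⊕ (u ⊕ v)  ∎
  where open ≡-Reasoning

⊕-swap : ∀ {d} (x y s : Vertex d) → y ⊕ (x ⊕ s) ≡ (x ⊕ y) ⊕ s
⊕-swap x y s = begin
  y ⊕ (x ⊕ s)  ≡⟨ sym (⊕-assoc y x s) ⟩
  (y ⊕ x) ⊕ s  ≡⟨ cong (_⊕ s) (⊕-comm y x) ⟩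
  (x ⊕ y) ⊕ s  ∎
  where open ≡-Reasoning

e-zero : ∀ {d} → e {suc d} zero ≡ true ∷ 0ᵛ
e-zero {d} = cong (true ∷_) (tabulate-false d)
  where
  tabulate-false : ∀ n → tabulate {n = n} (λ _ → false) ≡ 0ᵛ
  tabulate-false zero    = refl
  tabulate-false (suc n) = cong (false ∷_) (tabulate-false n)

flip-head : ∀ {d} (b : Bool) (v : Vertex d) → (b ∷ v) ⊕ e zero ≡ not b ∷ v
flip-head b v = trans (cong ((b ∷ v) ⊕_) e-zero) (cong₂ _∷_ (xor-comm b true) (⊕-identityʳ v))

-- Hamming weight: the number of ones.  wt (x ⊕ y) is the Hamming distance.

wt : ∀ {d} → Vertex d → ℕ
wt []          = 0
wt (true ∷ v)  = suc (wt v)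
wt (false ∷ v) = wt v

wt-0ᵛ : ∀ d → wt (0ᵛ {d}) ≡ 0
wt-0ᵛ zero    = refl
wt-0ᵛ (suc d) = wt-0ᵛ d

wt-self : ∀ {d} (v : Vertex d) → wt (v ⊕ v) ≡ 0
wt-self {d} v = trans (cong wt (⊕-self v)) (wt-0ᵛ d)

wt≡0⇒0ᵛ : ∀ {d} (v : Vertex d) → wt v ≡ 0 → v ≡ 0ᵛ
wt≡0⇒0ᵛ []          _ = refl
wt≡0⇒0ᵛ (false ∷ v) p = cong (false ∷_) (wt≡0⇒0ᵛ v p)

wt≡0⇒≡ : ∀ {d} (x y : Vertex d) → wt (x ⊕ y) ≡ 0 → x ≡ y
wt≡0⇒≡ x y p = begin
  x             ≡⟨ sym (⊕-identityʳ x) ⟩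
  x ⊕ 0ᵛ        ≡⟨ cong (x ⊕_) (sym (wt≡0⇒0ᵛ (x ⊕ y) p)) ⟩
  x ⊕ (x ⊕ y)   ≡⟨ ⊕-cancelˡ x y ⟩
  y             ∎
  where open ≡-Reasoning

wt≡1⇒basis : ∀ {d} (v : Vertex d) → wt v ≡ 1 → ∃ λ i → v ≡ e i
wt≡1⇒basis (true ∷ v) p =
  zero , trans (cong (true ∷_) (wt≡0⇒0ᵛ v (suc-injective p))) (sym e-zero)
wt≡1⇒basis (false ∷ v) p with wt≡1⇒basis v p
... | i , v≡eᵢ = suc i , cong (false ∷_) v≡eᵢ

wt-flip : ∀ {d} (v : Vertex d) (i : Fin d) →
          wt (v ⊕ e i) ≡ suc (wt v) ⊎ suc (wt (v ⊕ e i)) ≡ wt v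
wt-flip (b ∷ v) zero =
  subst (λ u → wt u ≡ suc (wt (b ∷ v)) ⊎ suc (wt u) ≡ wt (b ∷ v)) (sym (flip-head b v)) (flip-weight b)
  where
  flip-weight : ∀ b → wt (not b ∷ v) ≡ suc (wt (b ∷ v)) ⊎ suc (wt (not b ∷ v)) ≡ wt (b ∷ v)
  flip-weight true  = inj₂ refl
  flip-weight false = inj₁ refl
wt-flip (true ∷ v)  (suc i) with wt-flip v i
... | inj₁ up   = inj₁ (cong suc up)
... | inj₂ down = inj₂ (cong suc down)
wt-flip (false ∷ v) (suc i) = wt-flip v i

wt-drop : ∀ {d} (v : Vertex d) {w} → wt v ≡ suc w → ∃ λ i → wt (v ⊕ e i) ≡ w
wt-drop (true ∷ v) p = zero , trans (cong wt (flip-head true v)) (suc-injective p)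
wt-drop (false ∷ v) p with wt-drop v p
... | i , q = suc i , q

wt-complement : ∀ {d} (v : Vertex d) → wt (v ⊕ J) + wt v ≡ d
wt-complement []          = refl
wt-complement (true ∷ v)  = trans (+-suc (wt (v ⊕ J)) (wt v)) (cong suc (wt-complement v))
wt-complement (false ∷ v) = cong suc (wt-complement v)

data Walk {A : Set} (R : A → A → Set) : ℕ → A → A → Set where
  []  : ∀ {a} → Walk R 0 a a
  _∷_ : ∀ {a b c L} → R a b → Walk R L b c → Walk R (suc L) a c

mapWalk : ∀ {A B : Set} {R : A → A → Set} {S : B → B → Set} (g : A → B) →
          (∀ {a b} → R a b → S (g a) (g b)) → ∀ {L a b} → Walk R L a b → Walk S L (g a) (g b)
mapWalk g g-edge []       = []
mapWalk g g-edge (r ∷ rs) = g-edge r ∷ mapWalk g g-edge rs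

CubeAdj : ∀ {d} → Vertex d → Vertex d → Set
CubeAdj u v = ∃ λ i → u ⊕ v ≡ e i

cubeAdj-cons : ∀ {d} (b : Bool) {u v : Vertex d} → CubeAdj u v → CubeAdj (b ∷ u) (b ∷ v)
cubeAdj-cons b (i , p) = suc i , cong₂ _∷_ (xor-same b) p

cubeAdj-flip : ∀ {d} (b : Bool) (v : Vertex d) → CubeAdj (b ∷ v) (not b ∷ v)
cubeAdj-flip b v = zero , trans (cong₂ _∷_ (xor-not b) (⊕-self v)) (sym e-zero)
  where
  xor-not : ∀ b → b xor not b ≡ true
  xor-not true  = refl
  xor-not false = refl

cubeWalk : ∀ {d} (x y : Vertex d) → Walk CubeAdj (wt (x ⊕ y)) x y
cubeWalk []          []          = []
cubeWalk (true ∷ x)  (true ∷ y)  = mapWalk (true ∷_) (cubeAdj-cons true) (cubeWalk x y)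
cubeWalk (false ∷ x) (false ∷ y) = mapWalk (false ∷_) (cubeAdj-cons false) (cubeWalk x y)
cubeWalk (true ∷ x)  (false ∷ y) =
  cubeAdj-flip true x ∷ mapWalk (false ∷_) (cubeAdj-cons false) (cubeWalk x y)
cubeWalk (false ∷ x) (true ∷ y)  =
  cubeAdj-flip false x ∷ mapWalk (true ∷_) (cubeAdj-cons true) (cubeWalk x y)

hammingWalk : ∀ {d} (x y : Vertex d) → Walk Adj (wt (x ⊕ y)) x y
hammingWalk x y = mapWalk (λ v → v) inj₁ (cubeWalk x y)

parity : ℕ → Bool
parity zero    = false
parity (suc n) = not (parity n)

parity-+ : ∀ a b → parity (a + b) ≡ parity a xor parity b
parity-+ zero    b = refl
parity-+ (suc a) b = trans (cong not (parity-+ a b)) (not-distribˡ-xor (parity a) (parity b))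

parity-double : ∀ k → parity (2 * k) ≡ false
parity-double k = begin
  parity (k + (k + 0))              ≡⟨ parity-+ k (k + 0) ⟩
  parity k xor parity (k + 0)       ≡⟨ cong (λ m → parity k xor parity m) (+-identityʳ k) ⟩
  parity k xor parity k             ≡⟨ xor-same (parity k) ⟩
  false                             ∎
  where open ≡-Reasoning

parity-evenSum : ∀ a b → parity (a + b) ≡ false → parity a ≡ parity b
parity-evenSum a b p = xor≡false (trans (sym (parity-+ a b)) p)
  where
  xor≡false : ∀ {x y} → x xor y ≡ false → x ≡ y
  xor≡false {true}  {true}  _ = refl
  xor≡false {false} {false} _ = refl

parity-oddSum : ∀ a b → parity (a + b) ≡ true → parity a ≡ true ⊎ parity b ≡ true
parity-oddSum a b p = xor≡true (trans (sym (parity-+ a b)) p)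
  where
  xor≡true : ∀ {x y} → x xor y ≡ true → x ≡ true ⊎ y ≡ true
  xor≡true {true}  _ = inj₁ refl
  xor≡true {false} q = inj₂ q

-- Spanned n L w holds when a walk of length L can join two vertices at Hamming
-- distance w: with an even number of J-steps, L ≥ w and L ≡ w (mod 2); with an
-- odd number of J-steps, L + w ≥ n + 1 and L ≢ w (mod 2).

Spanned : ℕ → ℕ → ℕ → Set
Spanned n L w = (parity L ≡ parity w × w ≤ L) ⊎ (parity L ≡ not (parity w) × suc n ≤ L + w)

Spanned-basisStep : ∀ {n L w w′} → w′ ≡ suc w ⊎ suc w′ ≡ w → Spanned n L w → Spanned n (suc L) w′
Spanned-basisStep (inj₁ refl) (inj₁ (p , w≤L)) = inj₁ (cong not p , s≤s w≤L)
Spanned-basisStep {L = L} {w} (inj₁ refl) (inj₂ (p , n<L+w)) =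
  inj₂ (cong not p , ≤-trans n<L+w (+-mono-≤ (n≤1+n L) (n≤1+n w)))
Spanned-basisStep {L = L} {w′ = w′} (inj₂ refl) (inj₁ (p , w≤L)) =
  inj₁ (trans (cong not p) (not-involutive _) , ≤-trans (n≤1+n w′) (≤-trans w≤L (n≤1+n L)))
Spanned-basisStep {n} {L} {w′ = w′} (inj₂ refl) (inj₂ (p , n<L+w)) =
  inj₂ (cong not (trans p (not-involutive _)) , subst (suc n ≤_) (+-suc L w′) n<L+w)

Spanned-JStep : ∀ {n L w w′} → parity n ≡ false → w′ + w ≡ n → Spanned n L w → Spanned n (suc L) w′
Spanned-JStep {n} {L} {w} {w′} even w′+w≡n (inj₁ (p , w≤L)) =
  inj₂ (cong not (trans p (sym samePar)) , s≤s n≤L+w′)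
  where
  samePar : parity w′ ≡ parity w
  samePar = parity-evenSum w′ w (trans (cong parity w′+w≡n) even)
  n≤L+w′ : n ≤ L + w′
  n≤L+w′ = subst₂ _≤_ w′+w≡n (+-comm w′ L) (+-monoʳ-≤ w′ w≤L)
Spanned-JStep {n} {L} {w} {w′} even w′+w≡n (inj₂ (p , n<L+w)) =
  inj₁ (trans (cong not p) (trans (not-involutive _) (sym samePar)) , ≤-trans (n≤1+n w′) (s≤s w′≤L))
  where
  samePar : parity w′ ≡ parity w
  samePar = parity-evenSum w′ w (trans (cong parity w′+w≡n) even)
  w′≤L : w′ ≤ L
  w′≤L = ≤-trans (n≤1+n w′) (+-cancelʳ-≤ w (suc w′) L (subst (λ m → suc m ≤ L + w) (sym w′+w≡n) n<L+w))

walk-spanned : ∀ {n L} {a b : Vertex n} → parity n ≡ false → Walk Adj L a b → Spanned n L (wt (a ⊕ b))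
walk-spanned {n} {a = a} even [] = subst (Spanned n 0) (sym (wt-self a)) (inj₁ (refl , z≤n))
walk-spanned {n} {suc L} {a} even (_∷_ {b = b} {c} a~b rest) =
  subst (Spanned n (suc L)) (cong wt (sym (⊕-telescope a b c))) (step a~b)
  where
  step : IsGen (a ⊕ b) → Spanned n (suc L) (wt ((b ⊕ c) ⊕ (a ⊕ b)))
  step (inj₁ (i , p)) rewrite p = Spanned-basisStep (wt-flip (b ⊕ c) i) (walk-spanned even rest)
  step (inj₂ p)       rewrite p = Spanned-JStep even (wt-complement (b ⊕ c)) (walk-spanned even rest)

oddClosedWalk-long : ∀ {n L} {a : Vertex n} → parity n ≡ false → Walk Adj L a a → parity L ≡ true → suc n ≤ L
oddClosedWalk-long {n} {L} {a} even walk odd with subst (Spanned n L) (wt-self a) (walk-spanned even walk)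
... | inj₁ (p , _) with trans (sym odd) p
...   | ()
oddClosedWalk-long {n} {L} even walk odd | inj₂ (_ , n<L+0) = subst (suc n ≤_) (+-identityʳ L) n<L+0

shortClosedWalk : ∀ {n L} {a : Vertex n} → 2 ≤ n → parity n ≡ false → Walk Adj L a a →
                  L ≤ 2 → L ≡ 0 ⊎ L ≡ 2
shortClosedWalk {L = 0} _ _ _ _ = inj₁ refl
shortClosedWalk {L = 1} 2≤n even walk _ with ≤-trans (s≤s 2≤n) (oddClosedWalk-long even walk refl)
... | s≤s ()
shortClosedWalk {L = 2} _ _ _ _ = inj₂ refl
shortClosedWalk {L = suc (suc (suc _))} _ _ _ (s≤s (s≤s ()))

complement-short : ∀ n L₁ L₂ → L₁ + L₂ ≡ 3 + n → suc n ≤ L₁ → L₂ ≤ 2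
complement-short n L₁ L₂ sum n<L₁ =
  +-cancelʳ-≤ (suc n) L₂ 2 (subst (L₂ + suc n ≤_) (trans (+-comm L₂ L₁) sum) (+-monoʳ-≤ L₂ n<L₁))

-- Two closed walks in PC_n (n even) with lengths summing to n + 3: one length is
-- odd, hence at least n + 1, which leaves at most 2 for the other.
complementaryClosedWalks : ∀ {n L₁ L₂} {a b : Vertex n} → parity n ≡ false →
                           Walk Adj L₁ a a → Walk Adj L₂ b b → L₁ + L₂ ≡ 3 + n → L₁ ≤ 2 ⊎ L₂ ≤ 2
complementaryClosedWalks {n} {L₁} {L₂} even walk₁ walk₂ sum with parity-oddSum L₁ L₂ oddSum
  where
  oddSum : parity (L₁ + L₂) ≡ true
  oddSum = trans (cong parity sum) (trans (not-involutive (not (parity n))) (cong not even))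
... | inj₁ odd₁ = inj₂ (complement-short n L₁ L₂ sum (oddClosedWalk-long even walk₁ odd₁))
... | inj₂ odd₂ =
  inj₁ (complement-short n L₂ L₁ (trans (+-comm L₂ L₁) sum) (oddClosedWalk-long even walk₂ odd₂))

adj-translate : ∀ {d} {s : Vertex d} (u : Vertex d) → IsGen s → Adj u (u ⊕ s)
adj-translate {s = s} u gen = subst IsGen (sym (⊕-cancelˡ u s)) gen

distance2⇒commonNeighbour : ∀ {d} (x y : Vertex d) → wt (x ⊕ y) ≡ 2 → CommonNeighbour x y
distance2⇒commonNeighbour x y p with wt-drop (x ⊕ y) p
... | i , q with wt≡1⇒basis ((x ⊕ y) ⊕ e i) q
... | j , r = x ⊕ e i , adj-translate x (inj₁ (i , refl)) , inj₁ (j , trans (⊕-swap x y (e i)) r)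

nearComplement⇒commonNeighbour : ∀ {d} (x y : Vertex d) → wt ((x ⊕ J) ⊕ y) ≡ 1 → CommonNeighbour x y
nearComplement⇒commonNeighbour x y p with wt≡1⇒basis ((x ⊕ J) ⊕ y) p
... | j , r = x ⊕ J , adj-translate x (inj₂ refl) , inj₁ (j , trans (⊕-comm y (x ⊕ J)) r)

-- The two routes from x to y, directly and through x + J, have total length d + 1.
route-lengths : ∀ {d} (x y : Vertex d) → wt (x ⊕ y) + suc (wt ((x ⊕ J) ⊕ y)) ≡ suc d
route-lengths {d} x y = begin
  wt (x ⊕ y) + suc (wt ((x ⊕ J) ⊕ y))    ≡⟨ +-suc (wt (x ⊕ y)) _ ⟩
  suc (wt (x ⊕ y) + wt ((x ⊕ J) ⊕ y))    ≡⟨ cong suc (+-comm (wt (x ⊕ y)) _) ⟩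
  suc (wt ((x ⊕ J) ⊕ y) + wt (x ⊕ y))    ≡⟨ cong (λ v → suc (wt v + wt (x ⊕ y))) complement ⟩
  suc (wt ((x ⊕ y) ⊕ J) + wt (x ⊕ y))    ≡⟨ cong suc (wt-complement (x ⊕ y)) ⟩
  suc d                                   ∎
  where
  open ≡-Reasoning
  complement : (x ⊕ J) ⊕ y ≡ (x ⊕ y) ⊕ J
  complement = trans (⊕-comm (x ⊕ J) y) (⊕-swap x y J)

mainTheorem4 : (k : ℕ) → 1 ≤ k → (f : Vertex (2 + 2 * k) → Vertex (2 * k)) → IsHom f →
    (x y : Vertex (2 + 2 * k)) → ¬ (x ≡ y) → f x ≡ f y → CommonNeighbour x y
mainTheorem4 k 1≤k f hom x y x≢y fx≡fy =
  conclude (complementaryClosedWalks (parity-double k) (image direct) (image viaJ) (route-lengths x y))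
  where
  image : ∀ {L} → Walk Adj L x y → Walk Adj L (f x) (f x)
  image walk = subst (Walk Adj _ (f x)) (sym fx≡fy) (mapWalk f (λ {u} {v} → hom u v) walk)

  direct : Walk Adj (wt (x ⊕ y)) x y
  direct = hammingWalk x y

  viaJ : Walk Adj (suc (wt ((x ⊕ J) ⊕ y))) x y
  viaJ = adj-translate x (inj₂ refl) ∷ hammingWalk (x ⊕ J) y

  short : ∀ {L} → Walk Adj L x y → L ≤ 2 → L ≡ 0 ⊎ L ≡ 2
  short walk = shortClosedWalk (*-monoʳ-≤ 2 1≤k) (parity-double k) (image walk)

  conclude : wt (x ⊕ y) ≤ 2 ⊎ suc (wt ((x ⊕ J) ⊕ y)) ≤ 2 → CommonNeighbour x y
  conclude (inj₁ ≤2) with short direct ≤2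
  ... | inj₁ w≡0 = ⊥-elim (x≢y (wt≡0⇒≡ x y w≡0))
  ... | inj₂ w≡2 = distance2⇒commonNeighbour x y w≡2
  conclude (inj₂ ≤2) with short viaJ ≤2
  ... | inj₁ ()
  ... | inj₂ w′+1≡2 = nearComplement⇒commonNeighbour x y (suc-injective w′+1≡2)
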